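{- For all $n\ge1$, $a_{\{0101,0102\}}(n)=a_{\{0101,0121\}}(n)=F_{2n-1}$, where $F_1=F_2=1$ and $F_k=F_{k-1}+F_{k-2}$ for $k\ge3$.
   Context: An ascent in an integer sequence $s_1\cdots s_m$ is an index $j$ with $s_j<s_{j+1}$; $\mathrm{asc}(s)$ is the number of ascents. An ascent sequence is a sequence $x_1\cdots x_n$ of nonnegative integers with $x_1=0$ and $x_i\le 1+\mathrm{asc}(x_1\cdots x_{i-1})$ for $i\ge2$. For a sequence $w$, $\mathrm{red}(w)$ replaces the $i$-th smallest distinct letter of $w$ by $i-1$. A pattern (e.g. $0101$, meaning the sequence $(0,1,0,1)$) is a sequence equal to its reduction. A sequence $x$ contains pattern $p=p_1\cdots p_k$ if there are indices $i_1<\cdots<i_k$ with $\mathrm{red}(x_{i_1}\cdots x_{i_k})=p$; otherwise it avoids $p$. For a set of patterns $P$, $\mathcal A_n(P)$ is the set of ascent sequences of length $n$ avoiding every pattern in $P$, and $a_P(n)=|\mathcal A_n(P)|$. -}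

module Defs where

open import Data.Nat using (ℕ; zero; suc; _+_; _∸_; _<ᵇ_; _≤ᵇ_; _*_)
open import Data.Bool using (Bool; true; false; _∧_; _∨_; not; if_then_else_)
open import Data.List using (List; []; _∷_; length; filter; map; concatMap; upTo; deduplicate)
open import Data.Bool.ListAction using (any; all)
open import Data.Bool using (T)
open import Relation.Nullary.Decidable using (T?)
open import Data.List.Properties using (≡-dec)
open import Data.Nat.Properties using (_≟_)
open import Relation.Nullary.Decidable using (⌊_⌋)
open import Relation.Binary.PropositionalEquality using (_≡_)

Seq : Set
Seq = List ℕ

asc : Seq → ℕ
asc []           = 0
asc (a ∷ [])     = 0
asc (a ∷ b ∷ s)  = (if a <ᵇ b then 1 else 0) + asc (b ∷ s)

private
  rev : Seq → Seq
  rev = Data.List.reverse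

  go : Seq → Seq → Bool
  go pre []       = true
  go pre (x ∷ xs) = (x ≤ᵇ suc (asc pre)) ∧ go (pre Data.List.++ (x ∷ [])) xs

isAscentSeq : Seq → Bool
isAscentSeq []       = true
isAscentSeq (x ∷ xs) = ⌊ x ≟ 0 ⌋ ∧ go (x ∷ []) xs

-- red(w): replace the i-th smallest distinct letter of w by i-1,
-- i.e. each letter a becomes the number of distinct letters of w smaller than a.
red : Seq → Seq
red w = map (λ a → length (filter (λ b → b Data.Nat.<? a) (deduplicate _≟_ w))) w

subseqs : Seq → List Seq
subseqs []       = [] ∷ []
subseqs (x ∷ xs) = let r = subseqs xs in map (x ∷_) r Data.List.++ r

contains : Seq → Seq → Bool
contains x p = any (λ s → ⌊ ≡-dec _≟_ (red s) p ⌋) (subseqs x)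

avoidsAll : List Seq → Seq → Bool
avoidsAll P x = all (λ p → not (contains x p)) P

words : ℕ → ℕ → List Seq
words m zero    = [] ∷ []
words m (suc n) = concatMap (λ a → map (a ∷_) (words m n)) (upTo m)

-- A_n(P): ascent sequences of length n avoiding every pattern in P.
-- Every ascent sequence of length n has all entries < n (x_i ≤ i-1), so it
-- suffices to search among words of length n over {0,…,n-1}.
𝒜 : ℕ → List Seq → List Seq
𝒜 n P = filter (λ x → T? (isAscentSeq x ∧ avoidsAll P x)) (words n n)

a : List Seq → ℕ → ℕ
a P n = length (𝒜 n P)

F : ℕ → ℕ
F 0             = 0
F 1             = 1
F (suc (suc k)) = F (suc k) + F k

module Submission where

-- Both classes are recognised by automata that read a sequence from left to right and whose states
-- carry a single number.  An ascent sequence avoids {0101, 0102} iff it climbs from 0 in steps of 0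
-- or 1 and never rises again once it has descended; it avoids {0101, 0121} iff every nonzero entry
-- repeats its predecessor or is a new maximum.  Invariants on the prefix read so far show that the
-- automata accept exactly these sequences, and counting accepted words by their first letter turns
-- each automaton into a recurrence.  For {0101, 0121} the continuations of length j after a 0 and
-- after the maximum are counted by F(2j+1) and F(2j+2).  For {0101, 0102} the numbers I(k, j) of
-- continuations of a rising prefix with maximum k satisfy I(k+1, j+1) = I(k, j+1) + I(k+1, j), so
-- I(0, j) and I(1, j) are again consecutive Fibonacci numbers.

open import Defs
open import Data.Bool using (Bool; true; false; T; not; _∧_; if_then_else_)
open import Data.Bool.Properties using (∧-assoc; ∧-identityʳ; T-∧)
open import Data.Empty using (⊥; ⊥-elim)
open import Data.List
  using (List; []; _∷_; _++_; _∷ʳ_; length; map; filter; concatMap; deduplicate; last; upTo; foldl)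
open import Data.List.Membership.Propositional using (_∈_; find; lose)
open import Data.List.Membership.Propositional.Properties
  using (∈-deduplicate⁺; ∈-filter⁺; ∈-filter⁻; ∈-map⁺; ∈-map⁻; ∈-++⁺ˡ; ∈-++⁺ʳ; ∈-++⁻)
open import Data.List.Properties
  using (filter-++; filter-≐; upTo-∷ʳ; map-++; map-∘; map-cong; length-map; length-++;
         ∷ʳ-injective; ++-identityʳ; ++-assoc)
open import Data.List.Relation.Binary.Equality.Propositional using (≋⇒≡)
open import Data.List.Relation.Binary.Sublist.Propositional
  using (_⊆_; []; _∷_; ⊆-refl) renaming (_∷ʳ_ to _∷ʳ′_)
open import Data.List.Relation.Binary.Sublist.Propositional.Properties
  using (∷ˡ⁻; ++⁺; ++⁺ʳ; []⊆-universal; All-resp-⊆; filter⁺; length-mono-≤; to-≋)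
open import Data.List.Relation.Unary.All as All using (All)
open import Data.List.Relation.Unary.All.Properties as All using ()
open import Data.List.Relation.Unary.Any using (here; there)
open import Data.List.Relation.Unary.Any.Properties using (any⇔)
open import Data.Maybe using (just)
open import Data.Nat
  using (ℕ; zero; suc; _+_; _*_; _∸_; _≤_; _<_; _≥_; z≤n; s≤s; z<s; _≤?_; _<?_; _≤ᵇ_; _<ᵇ_)
open import Data.Nat.ListAction using (sum)
open import Data.Nat.ListAction.Properties using (sum-++)
open import Data.Nat.Properties
  using (_≟_; <-cmp; ≤-refl; ≤-trans; ≤-reflexive; ≤-pred; <-trans; <-≤-trans; ≤-<-trans; <⇒≤; <⇒≢;
         <⇒≱; ≰⇒>; ≤∧≢⇒<; n≮n; n≤1+n; n<1+n; 1+n≢n; 1+n≰n; m≤m+n; m≤n+m; m≤n⇒m≤1+n; m<n⇒m<1+n;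
         m≤n⇒m<n∨m≡n; +-comm; +-assoc; +-identityʳ; +-suc; +-monoʳ-≤; +-monoˡ-<; *-suc; ≤ᵇ⇒≤; ≤⇒≤ᵇ)
open import Data.Nat.Tactic.RingSolver using (solve-∀)
open import Data.Product using (_×_; _,_; proj₁; proj₂; ∃-syntax)
open import Data.Product.Function.NonDependent.Propositional using (_×-⇔_)
open import Data.Sum using (_⊎_; inj₁; inj₂)
open import Data.Unit using (tt)
open import Function using (_∘_; _⇔_; mk⇔; Equivalence)
open import Function.Properties.Equivalence
  using () renaming (refl to ⇔-refl; trans to ⇔-trans)
open import Relation.Binary.Core using (_Preserves_⟶_)
open import Relation.Binary.Definitions using (tri<; tri≈; tri>)
open import Relation.Binary.PropositionalEquality
  using (_≡_; _≢_; refl; sym; trans; cong; cong₂; subst; module ≡-Reasoning)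
open import Relation.Nullary using (¬_; Dec; yes; no; ¬?; contradiction)
open import Relation.Nullary.Decidable using (⌊_⌋; T?; toWitness; fromWitness)
open import Relation.Unary using (Pred; Decidable)

private
  variable
    c i j k l m n : ℕ
    p q s t x : Seq

filter-map : ∀ {A B : Set} {p q} {P : Pred B p} {Q : Pred A q} (P? : Decidable P) (Q? : Decidable Q)
             (f : A → B) → (∀ y → P (f y) ⇔ Q y) → ∀ ys → filter P? (map f ys) ≡ map f (filter Q? ys)
filter-map P? Q? f P⇔Q [] = refl
filter-map P? Q? f P⇔Q (y ∷ ys) with P? (f y) | Q? y
... | yes _ | yes _ = cong (f y ∷_) (filter-map P? Q? f P⇔Q ys)
... | no _  | no _  = filter-map P? Q? f P⇔Q ys
... | yes p | no ¬q = ⊥-elim (¬q (Equivalence.to (P⇔Q y) p))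
... | no ¬p | yes q = ⊥-elim (¬p (Equivalence.from (P⇔Q y) q))

length-filter-concatMap : ∀ {A B : Set} {p} {P : Pred B p} (P? : Decidable P) (g : A → List B) xs →
  length (filter P? (concatMap g xs)) ≡ sum (map (λ y → length (filter P? (g y))) xs)
length-filter-concatMap P? g [] = refl
length-filter-concatMap P? g (y ∷ xs) = begin
  length (filter P? (g y ++ concatMap g xs))
    ≡⟨ cong length (filter-++ P? (g y) (concatMap g xs)) ⟩
  length (filter P? (g y) ++ filter P? (concatMap g xs))
    ≡⟨ length-++ (filter P? (g y)) ⟩
  length (filter P? (g y)) + length (filter P? (concatMap g xs))
    ≡⟨ cong (length (filter P? (g y)) +_) (length-filter-concatMap P? g xs) ⟩
  length (filter P? (g y)) + sum (map (λ y → length (filter P? (g y))) xs)  ∎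
  where open ≡-Reasoning

T-not : ∀ {b} → T (not b) ⇔ (¬ T b)
T-not {true} = mk⇔ (λ ()) (λ ¬t → ¬t tt)
T-not {false} = mk⇔ (λ _ ()) (λ _ → tt)

⊆-∷ʳ : s ⊆ x → s ⊆ x ∷ʳ n
⊆-∷ʳ {n = n} = ++⁺ʳ (n ∷ [])

∷ʳ-⊆-∷ʳ : s ⊆ x → s ∷ʳ n ⊆ x ∷ʳ n
∷ʳ-⊆-∷ʳ σ = ++⁺ σ ⊆-refl

⊆-∷ʳ⁻ : s ⊆ x ∷ʳ n → s ⊆ x ⊎ ∃[ s′ ] (s ≡ s′ ∷ʳ n × s′ ⊆ x)
⊆-∷ʳ⁻ {x = []} (_ ∷ʳ′ []) = inj₁ []
⊆-∷ʳ⁻ {x = []} (refl ∷ []) = inj₂ ([] , refl , [])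
⊆-∷ʳ⁻ {x = y ∷ x} (y ∷ʳ′ σ) with ⊆-∷ʳ⁻ σ
... | inj₁ σ′ = inj₁ (y ∷ʳ′ σ′)
... | inj₂ (s′ , refl , σ′) = inj₂ (s′ , refl , y ∷ʳ′ σ′)
⊆-∷ʳ⁻ {x = y ∷ x} (refl ∷ σ) with ⊆-∷ʳ⁻ σ
... | inj₁ σ′ = inj₁ (refl ∷ σ′)
... | inj₂ (s′ , refl , σ′) = inj₂ (y ∷ s′ , refl , refl ∷ σ′)

∷ʳ-⊆-∷ʳ⁻ : ∀ s → s ∷ʳ m ⊆ x ∷ʳ n → s ∷ʳ m ⊆ x ⊎ (s ⊆ x × m ≡ n)
∷ʳ-⊆-∷ʳ⁻ s σ with ⊆-∷ʳ⁻ σ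
... | inj₁ σ′ = inj₁ σ′
... | inj₂ (s′ , eq , σ′) with ∷ʳ-injective s s′ eq
...   | refl , m≡n = inj₂ (σ′ , m≡n)

-- Reduction

rank : Seq → ℕ → ℕ
rank w i = length (filter (_<? i) (deduplicate _≟_ w))

rank-mono-≤ : ∀ w → i ≤ j → rank w i ≤ rank w j
rank-mono-≤ w i≤j =
  length-mono-≤ (filter⁺ (_<? _) (_<? _) (λ { refl k<i → <-≤-trans k<i i≤j })
                         (⊆-refl {x = deduplicate _≟_ w}))

rank-reflects-< : ∀ w → rank w i < rank w j → i < j
rank-reflects-< w r = ≰⇒> (λ j≤i → <⇒≱ r (rank-mono-≤ w j≤i))

-- If the ranks were equal, the two filtered lists would coincide, yet only one contains i.
rank-mono-< : ∀ w → i ∈ w → i < j → rank w i < rank w j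
rank-mono-< {i} {j} w i∈w i<j =
  ≤∧≢⇒< (rank-mono-≤ w (<⇒≤ i<j)) (λ eq → n≮n i (proj₂ (∈-filter⁻ (_<? i) {xs = L} (i∈below-i eq))))
  where
  L : Seq
  L = deduplicate _≟_ w
  below-i⊆below-j : filter (_<? i) L ⊆ filter (_<? j) L
  below-i⊆below-j = filter⁺ (_<? i) (_<? j) (λ { refl k<i → <-trans k<i i<j }) (⊆-refl {x = L})
  i∈below-i : rank w i ≡ rank w j → i ∈ filter (_<? i) L
  i∈below-i eq =
    subst (i ∈_) (sym (≋⇒≡ (to-≋ eq below-i⊆below-j))) (∈-filter⁺ (_<? j) (∈-deduplicate⁺ _≟_ i∈w) i<j)

rank-injective : ∀ w → i ∈ w → j ∈ w → rank w i ≡ rank w j → i ≡ j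
rank-injective {i} {j} w i∈w j∈w eq with <-cmp i j
... | tri< i<j _ _ = ⊥-elim (<⇒≢ (rank-mono-< w i∈w i<j) eq)
... | tri≈ _ i≡j _ = i≡j
... | tri> _ _ j<i = ⊥-elim (<⇒≢ (rank-mono-< w j∈w j<i) (sym eq))

module _ {f : ℕ → ℕ} (f-mono-< : f Preserves _<_ ⟶ _<_) where

  private
    f-injective : ∀ {i j} → f i ≡ f j → i ≡ j
    f-injective {i} {j} eq with <-cmp i j
    ... | tri< i<j _ _ = ⊥-elim (<⇒≢ (f-mono-< i<j) eq)
    ... | tri≈ _ i≡j _ = i≡j
    ... | tri> _ _ j<i = ⊥-elim (<⇒≢ (f-mono-< j<i) (sym eq))

    f-reflects-< : ∀ {i j} → f i < f j → i < j
    f-reflects-< fi<fj = ≰⇒> (λ j≤i → <⇒≱ fi<fj (f-mono j≤i))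
      where
      f-mono : ∀ {i j} → i ≤ j → f i ≤ f j
      f-mono {i} {j} i≤j with <-cmp i j
      ... | tri< i<j _ _ = <⇒≤ (f-mono-< i<j)
      ... | tri≈ _ refl _ = ≤-refl
      ... | tri> _ _ j<i = ⊥-elim (<⇒≱ j<i i≤j)

  deduplicate-map : ∀ s → deduplicate _≟_ (map f s) ≡ map f (deduplicate _≟_ s)
  deduplicate-map [] = refl
  deduplicate-map (i ∷ s) = cong (f i ∷_) (begin
    filter (¬? ∘ (f i ≟_)) (deduplicate _≟_ (map f s))  ≡⟨ cong (filter _) (deduplicate-map s) ⟩
    filter (¬? ∘ (f i ≟_)) (map f (deduplicate _≟_ s))  ≡⟨ filter-map _ _ f f-≢ (deduplicate _≟_ s) ⟩
    map f (filter (¬? ∘ (i ≟_)) (deduplicate _≟_ s))    ∎)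
    where
    open ≡-Reasoning
    f-≢ : ∀ j → f i ≢ f j ⇔ i ≢ j
    f-≢ j = mk⇔ (λ ne → ne ∘ cong f) (λ ne → ne ∘ f-injective)

  rank-map : ∀ s i → rank (map f s) (f i) ≡ rank s i
  rank-map s i = begin
    length (filter (_<? f i) (deduplicate _≟_ (map f s)))  ≡⟨ cong (length ∘ filter _) (deduplicate-map s) ⟩
    length (filter (_<? f i) (map f L))                    ≡⟨ cong length (filter-map _ _ f f-< L) ⟩
    length (map f (filter (_<? i) L))                      ≡⟨ length-map f (filter (_<? i) L) ⟩
    rank s i                                               ∎
    where
    open ≡-Reasoning
    L : Seq
    L = deduplicate _≟_ s
    f-< : ∀ j → f j < f i ⇔ j < i
    f-< j = mk⇔ f-reflects-< f-mono-<

  red-map : ∀ s → red (map f s) ≡ red s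
  red-map s = trans (sym (map-∘ s)) (map-cong (rank-map s) s)

spread : ℕ → ℕ → ℕ → ℕ → ℕ
spread i j k zero = i
spread i j k (suc zero) = j
spread i j k (suc (suc n)) = n + k

spread-< : i < j → j < k → spread i j k Preserves _<_ ⟶ _<_
spread-< i<j j<k {zero} {suc zero} _ = i<j
spread-< i<j j<k {zero} {suc (suc n)} _ = <-≤-trans (<-trans i<j j<k) (m≤n+m _ n)
spread-< i<j j<k {suc zero} {suc zero} (s≤s ())
spread-< i<j j<k {suc zero} {suc (suc n)} _ = <-≤-trans j<k (m≤n+m _ n)
spread-< i<j j<k {suc (suc m)} {suc (suc n)} (s≤s (s≤s m<n)) = +-monoˡ-< _ m<n

p0101 p0102 p0121 : Seq
p0101 = 0 ∷ 1 ∷ 0 ∷ 1 ∷ []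
p0102 = 0 ∷ 1 ∷ 0 ∷ 2 ∷ []
p0121 = 0 ∷ 1 ∷ 2 ∷ 1 ∷ []

module _ {a b c d : ℕ} where

  private
    w : Seq
    w = a ∷ b ∷ c ∷ d ∷ []

    ranks : red w ≡ i ∷ j ∷ k ∷ l ∷ [] →
            rank w a ≡ i × rank w b ≡ j × rank w c ≡ k × rank w d ≡ l
    ranks refl = refl , refl , refl , refl

    ranked-< : ∀ {x y} → rank w x ≡ i → rank w y ≡ j → i < j → x < y
    ranked-< refl refl = rank-reflects-< w

    ranked-≡ : ∀ {x y} → x ∈ w → y ∈ w → rank w x ≡ i → rank w y ≡ i → x ≡ y
    ranked-≡ x∈w y∈w refl eq = rank-injective w x∈w y∈w (sym eq)

    a∈w : a ∈ w
    a∈w = here refl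
    b∈w : b ∈ w
    b∈w = there (here refl)
    c∈w : c ∈ w
    c∈w = there (there (here refl))
    d∈w : d ∈ w
    d∈w = there (there (there (here refl)))

  red≡0101 : red w ≡ p0101 ⇔ (a < b × c ≡ a × d ≡ b)
  red≡0101 = mk⇔ to from
    where
    to : red w ≡ p0101 → a < b × c ≡ a × d ≡ b
    to eq with ranks eq
    ... | ra , rb , rc , rd =
      ranked-< ra rb (s≤s z≤n) , ranked-≡ c∈w a∈w rc ra , ranked-≡ d∈w b∈w rd rb
    from : a < b × c ≡ a × d ≡ b → red w ≡ p0101
    from (a<b , refl , refl) = red-map (spread-< a<b ≤-refl) p0101

  red≡0102 : red w ≡ p0102 ⇔ (a < b × c ≡ a × b < d)
  red≡0102 = mk⇔ to from
    where
    to : red w ≡ p0102 → a < b × c ≡ a × b < d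
    to eq with ranks eq
    ... | ra , rb , rc , rd =
      ranked-< ra rb (s≤s z≤n) , ranked-≡ c∈w a∈w rc ra , ranked-< rb rd (s≤s (s≤s z≤n))
    from : a < b × c ≡ a × b < d → red w ≡ p0102
    from (a<b , refl , b<d) = red-map (spread-< a<b b<d) p0102

  red≡0121 : red w ≡ p0121 ⇔ (a < b × b < c × d ≡ b)
  red≡0121 = mk⇔ to from
    where
    to : red w ≡ p0121 → a < b × b < c × d ≡ b
    to eq with ranks eq
    ... | ra , rb , rc , rd =
      ranked-< ra rb (s≤s z≤n) , ranked-< rb rc (s≤s (s≤s z≤n)) , ranked-≡ d∈w b∈w rd rb
    from : a < b × b < c × d ≡ b → red w ≡ p0121
    from (a<b , b<c , refl) = red-map (spread-< a<b b<c) p0121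

-- Containment

∈-subseqs⁺ : s ⊆ x → s ∈ subseqs x
∈-subseqs⁺ [] = here refl
∈-subseqs⁺ (_∷ʳ′_ {ys = x} y σ) = ∈-++⁺ʳ (map (y ∷_) (subseqs x)) (∈-subseqs⁺ σ)
∈-subseqs⁺ (refl ∷ σ) = ∈-++⁺ˡ (∈-map⁺ (_ ∷_) (∈-subseqs⁺ σ))

∈-subseqs⁻ : ∀ x → s ∈ subseqs x → s ⊆ x
∈-subseqs⁻ [] (here refl) = []
∈-subseqs⁻ (y ∷ x) s∈ with ∈-++⁻ (map (y ∷_) (subseqs x)) s∈
... | inj₁ s∈map with ∈-map⁻ (y ∷_) s∈map
...   | s′ , s′∈ , refl = refl ∷ ∈-subseqs⁻ x s′∈
∈-subseqs⁻ (y ∷ x) s∈ | inj₂ s∈rest = y ∷ʳ′ ∈-subseqs⁻ x s∈rest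

T-contains : T (contains x p) ⇔ (∃[ s ] (s ⊆ x × red s ≡ p))
T-contains {x} {p} = mk⇔ to from
  where
  to : T (contains x p) → ∃[ s ] (s ⊆ x × red s ≡ p)
  to h with find (Equivalence.from any⇔ h)
  ... | s , s∈ , found = s , ∈-subseqs⁻ x s∈ , toWitness found
  from : ∃[ s ] (s ⊆ x × red s ≡ p) → T (contains x p)
  from (s , σ , eq) = Equivalence.to any⇔ (lose (∈-subseqs⁺ σ) (fromWitness eq))

Avoids : Seq → Seq → Set
Avoids p x = ∀ {s} → s ⊆ x → red s ≢ p

avoids-short : length x < length p → Avoids p x
avoids-short {x} x<p {s} σ eq =
  <⇒≱ x<p (subst (_≤ length x) (trans (sym (length-map _ s)) (cong length eq)) (length-mono-≤ σ))

T-avoids : T (not (contains x p)) ⇔ Avoids p x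
T-avoids {x} {p} = mk⇔ to from
  where
  to : T (not (contains x p)) → Avoids p x
  to h {s} σ eq =
    Equivalence.to (T-not {contains x p}) h (Equivalence.from (T-contains {x} {p}) (s , σ , eq))
  from : Avoids p x → T (not (contains x p))
  from av = Equivalence.from (T-not {contains x p}) λ h →
    let _ , σ , eq = Equivalence.to (T-contains {x} {p}) h in av σ eq

-- Ascent sequences

-- `go` is private in Defs; unification against the body of isAscentSeq solves this
-- metavariable to it once the with-clause has abstracted the singleton prefix.
ascentCheck : Seq → Seq → Bool
isAscentSeq-∷ : ∀ h t → isAscentSeq (h ∷ t) ≡ ⌊ h ≟ 0 ⌋ ∧ ascentCheck (h ∷ []) t

ascentCheck = _
isAscentSeq-∷ h t with h ∷ []
... | _ = refl

ascentCheck-∷ʳ : ∀ pre t → ascentCheck pre (t ∷ʳ n) ≡ ascentCheck pre t ∧ (n ≤ᵇ suc (asc (pre ++ t)))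
ascentCheck-∷ʳ {n} pre [] =
  trans (∧-identityʳ (n ≤ᵇ suc (asc pre))) (cong (λ y → n ≤ᵇ suc (asc y)) (sym (++-identityʳ pre)))
ascentCheck-∷ʳ {n} pre (y ∷ t) = begin
  y-fits ∧ ascentCheck (pre ∷ʳ y) (t ∷ʳ n)
    ≡⟨ cong (y-fits ∧_) (ascentCheck-∷ʳ (pre ∷ʳ y) t) ⟩
  y-fits ∧ (ascentCheck (pre ∷ʳ y) t ∧ n-fits (pre ∷ʳ y ++ t))
    ≡⟨ ∧-assoc y-fits (ascentCheck (pre ∷ʳ y) t) _ ⟨
  (y-fits ∧ ascentCheck (pre ∷ʳ y) t) ∧ n-fits (pre ∷ʳ y ++ t)
    ≡⟨ cong (λ z → (y-fits ∧ ascentCheck (pre ∷ʳ y) t) ∧ n-fits z) (++-assoc pre (y ∷ []) t) ⟩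
  ascentCheck pre (y ∷ t) ∧ n-fits (pre ++ y ∷ t)
    ∎
  where
  open ≡-Reasoning
  y-fits : Bool
  y-fits = y ≤ᵇ suc (asc pre)
  n-fits : Seq → Bool
  n-fits z = n ≤ᵇ suc (asc z)

isAscentSeq-∷ʳ : ∀ h t → T (isAscentSeq (h ∷ t ∷ʳ n)) ⇔ (T (isAscentSeq (h ∷ t)) × n ≤ suc (asc (h ∷ t)))
isAscentSeq-∷ʳ {n} h t =
  subst (λ b → T b ⇔ (T (isAscentSeq (h ∷ t)) × n ≤ suc (asc (h ∷ t)))) (sym split)
    (⇔-trans (T-∧ {isAscentSeq (h ∷ t)}) (⇔-refl ×-⇔ mk⇔ (≤ᵇ⇒≤ n _) ≤⇒≤ᵇ))
  where
  h-fits n-fits : Bool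
  h-fits = ⌊ h ≟ 0 ⌋
  n-fits = n ≤ᵇ suc (asc (h ∷ t))
  split : isAscentSeq (h ∷ t ∷ʳ n) ≡ isAscentSeq (h ∷ t) ∧ n-fits
  split = begin
    isAscentSeq (h ∷ t ∷ʳ n)                           ≡⟨ isAscentSeq-∷ h (t ∷ʳ n) ⟩
    h-fits ∧ ascentCheck (h ∷ []) (t ∷ʳ n)             ≡⟨ cong (h-fits ∧_) (ascentCheck-∷ʳ (h ∷ []) t) ⟩
    h-fits ∧ (ascentCheck (h ∷ []) t ∧ n-fits)         ≡⟨ ∧-assoc h-fits (ascentCheck (h ∷ []) t) n-fits ⟨
    (h-fits ∧ ascentCheck (h ∷ []) t) ∧ n-fits         ≡⟨ cong (_∧ n-fits) (isAscentSeq-∷ h t) ⟨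
    isAscentSeq (h ∷ t) ∧ n-fits                       ∎
    where open ≡-Reasoning

last-∷ʳ : ∀ x → last (x ∷ʳ n) ≡ just n
last-∷ʳ [] = refl
last-∷ʳ (y ∷ []) = refl
last-∷ʳ (y ∷ z ∷ x) = last-∷ʳ (z ∷ x)

last-⊆ : ∀ x → last x ≡ just n → n ∷ [] ⊆ x
last-⊆ (y ∷ []) refl = refl ∷ []
last-⊆ (y ∷ z ∷ x) eq = y ∷ʳ′ last-⊆ (z ∷ x) eq

asc-∷ʳ : ∀ x → last x ≡ just m → asc (x ∷ʳ n) ≡ asc x + asc (m ∷ n ∷ [])
asc-∷ʳ (y ∷ []) refl = refl
asc-∷ʳ {n = n} (y ∷ z ∷ x) eq =
  trans (cong (y<z +_) (asc-∷ʳ (z ∷ x) eq)) (sym (+-assoc y<z (asc (z ∷ x)) _))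
  where
  y<z : ℕ
  y<z = if y <ᵇ z then 1 else 0

asc-∷ʳ-mono : ∀ x → asc x ≤ asc (x ∷ʳ n)
asc-∷ʳ-mono [] = z≤n
asc-∷ʳ-mono (y ∷ []) = z≤n
asc-∷ʳ-mono (y ∷ z ∷ x) = +-monoʳ-≤ _ (asc-∷ʳ-mono (z ∷ x))

asc-pair-≤ : n ≤ m → asc (m ∷ n ∷ []) ≡ 0
asc-pair-≤ z≤n = refl
asc-pair-≤ (s≤s n≤m) = asc-pair-≤ n≤m

asc-pair-< : m < n → asc (m ∷ n ∷ []) ≡ 1
asc-pair-< (s≤s z≤n) = refl
asc-pair-< (s≤s (s≤s m<n)) = asc-pair-< (s≤s m<n)

asc-∷ʳ-≤ : ∀ x → last x ≡ just m → n ≤ m → asc (x ∷ʳ n) ≡ asc x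
asc-∷ʳ-≤ x eq n≤m =
  trans (asc-∷ʳ x eq) (trans (cong (asc x +_) (asc-pair-≤ n≤m)) (+-identityʳ (asc x)))

asc-∷ʳ-< : ∀ x → last x ≡ just m → m < n → asc (x ∷ʳ n) ≡ suc (asc x)
asc-∷ʳ-< x eq m<n =
  trans (asc-∷ʳ x eq) (trans (cong (asc x +_) (asc-pair-< m<n)) (+-comm (asc x) 1))

-- Appending an entry

AscentAvoiding : Seq → Seq → Seq → Set
AscentAvoiding p q x = T (isAscentSeq x) × Avoids p x × Avoids q x

T-ascentAvoiding : T (isAscentSeq x ∧ avoidsAll (p ∷ q ∷ []) x) ⇔ AscentAvoiding p q x
T-ascentAvoiding {x} {p} {q} =
  ⇔-trans (T-∧ {isAscentSeq x})
          (⇔-refl ×-⇔ ⇔-trans (T-∧ {not (contains x p)}) (T-avoids {x} {p} ×-⇔ T-avoids-q))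
  where
  T-avoids-q : T (not (contains x q) ∧ true) ⇔ Avoids q x
  T-avoids-q = ⇔-trans (T-∧ {not (contains x q)}) (⇔-trans (mk⇔ proj₁ (_, tt)) (T-avoids {x} {q}))

ascentAvoiding-short : T (isAscentSeq x) → length x < length p → length x < length q → AscentAvoiding p q x
ascentAvoiding-short ascent x<p x<q = ascent , avoids-short x<p , avoids-short x<q

AvoidsAtEnd : Seq → Seq → ℕ → Set
AvoidsAtEnd p x n = ∀ {s} → s ⊆ x → red (s ∷ʳ n) ≢ p

avoids-∷ʳ : Avoids p (x ∷ʳ n) ⇔ (Avoids p x × AvoidsAtEnd p x n)
avoids-∷ʳ {p} {x} {n} = mk⇔ to from
  where
  to : Avoids p (x ∷ʳ n) → Avoids p x × AvoidsAtEnd p x n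
  to av = (λ σ → av (⊆-∷ʳ σ)) , (λ σ → av (∷ʳ-⊆-∷ʳ σ))
  from : Avoids p x × AvoidsAtEnd p x n → Avoids p (x ∷ʳ n)
  from (av , av-end) σ with ⊆-∷ʳ⁻ σ
  ... | inj₁ σ′ = av σ′
  ... | inj₂ (_ , refl , σ′) = av-end σ′

ascentAvoiding-∷ʳ : ∀ h t →
  AscentAvoiding p q (h ∷ t ∷ʳ n) ⇔
  (AscentAvoiding p q (h ∷ t) × n ≤ suc (asc (h ∷ t)) ×
   AvoidsAtEnd p (h ∷ t) n × AvoidsAtEnd q (h ∷ t) n)
ascentAvoiding-∷ʳ {p} {q} {n} h t = mk⇔ to from
  where
  to : AscentAvoiding p q (h ∷ t ∷ʳ n) →
       AscentAvoiding p q (h ∷ t) × n ≤ suc (asc (h ∷ t)) ×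
       AvoidsAtEnd p (h ∷ t) n × AvoidsAtEnd q (h ∷ t) n
  to (ascent , avp , avq) with Equivalence.to (isAscentSeq-∷ʳ h t) ascent
                             | Equivalence.to avoids-∷ʳ avp | Equivalence.to avoids-∷ʳ avq
  ... | ascent′ , n≤ | avp′ , endp | avq′ , endq = (ascent′ , avp′ , avq′) , n≤ , endp , endq
  from : AscentAvoiding p q (h ∷ t) × n ≤ suc (asc (h ∷ t)) ×
         AvoidsAtEnd p (h ∷ t) n × AvoidsAtEnd q (h ∷ t) n →
         AscentAvoiding p q (h ∷ t ∷ʳ n)
  from ((ascent , avp , avq) , n≤ , endp , endq) =
    Equivalence.from (isAscentSeq-∷ʳ h t) (ascent , n≤) ,
    Equivalence.from avoids-∷ʳ (avp , endp) , Equivalence.from avoids-∷ʳ (avq , endq)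

avoidsAtEnd-triples : length p ≡ 4 →
  AvoidsAtEnd p x n ⇔ (∀ {i j k} → i ∷ j ∷ k ∷ [] ⊆ x → red (i ∷ j ∷ k ∷ n ∷ []) ≢ p)
avoidsAtEnd-triples {p} {x} {n} len≡4 = mk⇔ (λ av {i j k} → av {i ∷ j ∷ k ∷ []}) from
  where
  length≡4 : ∀ s → red (s ∷ʳ n) ≡ p → suc (length s) ≡ 4
  length≡4 s eq = begin
    suc (length s)            ≡⟨ +-comm 1 (length s) ⟩
    length s + 1              ≡⟨ length-++ s ⟨
    length (s ∷ʳ n)           ≡⟨ length-map _ (s ∷ʳ n) ⟨
    length (red (s ∷ʳ n))     ≡⟨ cong length eq ⟩
    length p                  ≡⟨ len≡4 ⟩
    4                         ∎
    where open ≡-Reasoning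
  from : (∀ {i j k} → i ∷ j ∷ k ∷ [] ⊆ x → red (i ∷ j ∷ k ∷ n ∷ []) ≢ p) → AvoidsAtEnd p x n
  from av {i ∷ j ∷ k ∷ []} σ eq = av σ eq
  from av {[]} σ eq = contradiction (length≡4 [] eq) λ ()
  from av {_ ∷ []} σ eq = contradiction (length≡4 (_ ∷ []) eq) λ ()
  from av {_ ∷ _ ∷ []} σ eq = contradiction (length≡4 (_ ∷ _ ∷ []) eq) λ ()
  from av {s@(_ ∷ _ ∷ _ ∷ _ ∷ _)} σ eq = contradiction (length≡4 s eq) λ ()

avoidsAtEnd-0101 : AvoidsAtEnd p0101 x n ⇔ (∀ {i} → i < n → ¬ i ∷ n ∷ i ∷ [] ⊆ x)
avoidsAtEnd-0101 {x} {n} = mk⇔ to from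
  where
  to : AvoidsAtEnd p0101 x n → ∀ {i} → i < n → ¬ i ∷ n ∷ i ∷ [] ⊆ x
  to av i<n σ = av σ (Equivalence.from red≡0101 (i<n , refl , refl))
  from : (∀ {i} → i < n → ¬ i ∷ n ∷ i ∷ [] ⊆ x) → AvoidsAtEnd p0101 x n
  from h = Equivalence.from (avoidsAtEnd-triples {p0101} refl) no-triple
    where
    no-triple : ∀ {i j k} → i ∷ j ∷ k ∷ [] ⊆ x → red (i ∷ j ∷ k ∷ n ∷ []) ≢ p0101
    no-triple {i} {j} {k} σ eq with Equivalence.to (red≡0101 {i} {j} {k} {n}) eq
    ... | i<j , refl , refl = h i<j σ

avoidsAtEnd-0102 : AvoidsAtEnd p0102 x n ⇔ (∀ {i j} → i < j → j < n → ¬ i ∷ j ∷ i ∷ [] ⊆ x)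
avoidsAtEnd-0102 {x} {n} = mk⇔ to from
  where
  to : AvoidsAtEnd p0102 x n → ∀ {i j} → i < j → j < n → ¬ i ∷ j ∷ i ∷ [] ⊆ x
  to av i<j j<n σ = av σ (Equivalence.from red≡0102 (i<j , refl , j<n))
  from : (∀ {i j} → i < j → j < n → ¬ i ∷ j ∷ i ∷ [] ⊆ x) → AvoidsAtEnd p0102 x n
  from h = Equivalence.from (avoidsAtEnd-triples {p0102} refl) no-triple
    where
    no-triple : ∀ {i j k} → i ∷ j ∷ k ∷ [] ⊆ x → red (i ∷ j ∷ k ∷ n ∷ []) ≢ p0102
    no-triple {i} {j} {k} σ eq with Equivalence.to (red≡0102 {i} {j} {k} {n}) eq
    ... | i<j , refl , j<n = h i<j j<n σ

avoidsAtEnd-0121 : AvoidsAtEnd p0121 x n ⇔ (∀ {i k} → i < n → n < k → ¬ i ∷ n ∷ k ∷ [] ⊆ x)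
avoidsAtEnd-0121 {x} {n} = mk⇔ to from
  where
  to : AvoidsAtEnd p0121 x n → ∀ {i k} → i < n → n < k → ¬ i ∷ n ∷ k ∷ [] ⊆ x
  to av i<n n<k σ = av σ (Equivalence.from red≡0121 (i<n , n<k , refl))
  from : (∀ {i k} → i < n → n < k → ¬ i ∷ n ∷ k ∷ [] ⊆ x) → AvoidsAtEnd p0121 x n
  from h = Equivalence.from (avoidsAtEnd-triples {p0121} refl) no-triple
    where
    no-triple : ∀ {i j k} → i ∷ j ∷ k ∷ [] ⊆ x → red (i ∷ j ∷ k ∷ n ∷ []) ≢ p0121
    no-triple {i} {j} {k} σ eq with Equivalence.to (red≡0121 {i} {j} {k} {n}) eq
    ... | i<j , j<k , refl = h i<j j<k σ

-- Counting the words accepted by an automaton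

∑< : ℕ → (ℕ → ℕ) → ℕ
∑< zero f = 0
∑< (suc m) f = ∑< m f + f m

sum-map-upTo : ∀ (f : ℕ → ℕ) m → sum (map f (upTo m)) ≡ ∑< m f
sum-map-upTo f zero = refl
sum-map-upTo f (suc m) = begin
  sum (map f (upTo (suc m)))          ≡⟨ cong (sum ∘ map f) (upTo-∷ʳ m) ⟨
  sum (map f (upTo m ∷ʳ m))           ≡⟨ cong sum (map-++ f (upTo m) (m ∷ [])) ⟩
  sum (map f (upTo m) ++ f m ∷ [])    ≡⟨ sum-++ (map f (upTo m)) (f m ∷ []) ⟩
  sum (map f (upTo m)) + (f m + 0)    ≡⟨ cong₂ _+_ (sum-map-upTo f m) (+-identityʳ (f m)) ⟩
  ∑< m f + f m                        ∎
  where open ≡-Reasoning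

∑<-cong : ∀ {f g : ℕ → ℕ} m → (∀ {i} → i < m → f i ≡ g i) → ∑< m f ≡ ∑< m g
∑<-cong zero f≗g = refl
∑<-cong (suc m) f≗g = cong₂ _+_ (∑<-cong m (f≗g ∘ m<n⇒m<1+n)) (f≗g ≤-refl)

∑<-vanishing-tail : ∀ {f : ℕ → ℕ} → k ≤ m → (∀ {i} → k ≤ i → i < m → f i ≡ 0) → ∑< m f ≡ ∑< k f
∑<-vanishing-tail {m = zero} z≤n f≡0 = refl
∑<-vanishing-tail {k} {suc m} {f} k≤1+m f≡0 with m≤n⇒m<n∨m≡n k≤1+m
... | inj₂ refl = refl
... | inj₁ (s≤s k≤m) = begin
  ∑< m f + f m
    ≡⟨ cong₂ _+_ (∑<-vanishing-tail k≤m (λ k≤i i<m → f≡0 k≤i (m<n⇒m<1+n i<m))) (f≡0 k≤m ≤-refl) ⟩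
  ∑< k f + 0    ≡⟨ +-identityʳ (∑< k f) ⟩
  ∑< k f        ∎
  where open ≡-Reasoning

∑<-head : ∀ {f : ℕ → ℕ} k → (∀ {i} → i < k → f (suc i) ≡ 0) → ∑< (suc k) f ≡ f 0
∑<-head zero f≡0 = refl
∑<-head {f} (suc k) f≡0 = begin
  ∑< (suc k) f + f (suc k)  ≡⟨ cong₂ _+_ (∑<-head k (f≡0 ∘ m<n⇒m<1+n)) (f≡0 ≤-refl) ⟩
  f 0 + 0                   ≡⟨ +-identityʳ (f 0) ⟩
  f 0                       ∎
  where open ≡-Reasoning

module Automaton {S : Set} (step : S → ℕ → S) (accepts : S → Bool) where

  run : S → Seq → S
  run = foldl step

  accepted : ℕ → S → ℕ → ℕ
  accepted m s n = length (filter (λ x → T? (accepts (run s x))) (words m n))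

  accepted-suc : ∀ m s n → accepted m s (suc n) ≡ ∑< m (λ i → accepted m (step s i) n)
  accepted-suc m s n = begin
    length (filter P? (concatMap (λ i → map (i ∷_) (words m n)) (upTo m)))
      ≡⟨ length-filter-concatMap P? (λ i → map (i ∷_) (words m n)) (upTo m) ⟩
    sum (map (λ i → length (filter P? (map (i ∷_) (words m n)))) (upTo m))
      ≡⟨ cong sum (map-cong first-letter (upTo m)) ⟩
    sum (map (λ i → accepted m (step s i) n) (upTo m))
      ≡⟨ sum-map-upTo _ m ⟩
    ∑< m (λ i → accepted m (step s i) n)  ∎
    where
    open ≡-Reasoning
    P? : (x : Seq) → Dec (T (accepts (run s x)))
    P? x = T? (accepts (run s x))
    first-letter : ∀ i → length (filter P? (map (i ∷_) (words m n))) ≡ accepted m (step s i) n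
    first-letter i = begin
      length (filter P? (map (i ∷_) (words m n)))
        ≡⟨ cong length (filter-map P? Q? (i ∷_) (λ _ → ⇔-refl) (words m n)) ⟩
      length (map (i ∷_) (filter Q? (words m n)))
        ≡⟨ length-map (i ∷_) (filter Q? (words m n)) ⟩
      accepted m (step s i) n
        ∎
      where
      Q? : (x : Seq) → Dec (T (accepts (run (step s i) x)))
      Q? x = T? (accepts (run (step s i) x))

  accepted-absorbing : ∀ {s} → (∀ i → step s i ≡ s) → ¬ T (accepts s) → ∀ m n → accepted m s n ≡ 0
  accepted-absorbing {s} absorbs rejects m zero with accepts s
  ... | true = contradiction tt rejects
  ... | false = refl
  accepted-absorbing {s} absorbs rejects m (suc n) = begin
    accepted m s (suc n)                  ≡⟨ accepted-suc m s n ⟩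
    ∑< m (λ i → accepted m (step s i) n)
      ≡⟨ ∑<-cong m (λ {i} _ → cong (λ s′ → accepted m s′ n) (absorbs i)) ⟩
    ∑< m (λ _ → accepted m s n)
      ≡⟨ ∑<-vanishing-tail {m = m} z≤n (λ _ _ → accepted-absorbing absorbs rejects m n) ⟩
    0                                     ∎
    where open ≡-Reasoning

  run-invariant : (Inv : S → Seq → Set) → (∀ {s t} n → Inv s t → Inv (step s n) (t ∷ʳ n)) →
                  ∀ u {s t} → Inv s t → Inv (run s u) (t ++ u)
  run-invariant Inv inv-step [] {s} {t} inv = subst (Inv s) (sym (++-identityʳ t)) inv
  run-invariant Inv inv-step (n ∷ u) {s} {t} inv =
    subst (Inv (run s (n ∷ u))) (++-assoc t (n ∷ []) u) (run-invariant Inv inv-step u (inv-step n inv))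

  run-absorbing : ∀ {s} → (∀ i → step s i ≡ s) → ∀ u → run s u ≡ s
  run-absorbing absorbs [] = refl
  run-absorbing {s} absorbs (i ∷ u) =
    trans (cong (λ s′ → run s′ u) (absorbs i)) (run-absorbing absorbs u)

  a≡accepted : ∀ s → (∀ x → T (accepts (run s x)) ⇔ AscentAvoiding p q x) →
               ∀ n → a (p ∷ q ∷ []) n ≡ accepted n s n
  a≡accepted {p} {q} s accepts⇔ n =
    cong length (filter-≐ P? accepts? ((λ {x} → to x) , (λ {x} → from x)) (words n n))
    where
    P? : (x : Seq) → Dec (T (isAscentSeq x ∧ avoidsAll (p ∷ q ∷ []) x))
    P? x = T? (isAscentSeq x ∧ avoidsAll (p ∷ q ∷ []) x)
    accepts? : (x : Seq) → Dec (T (accepts (run s x)))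
    accepts? x = T? (accepts (run s x))
    to : ∀ x → T (isAscentSeq x ∧ avoidsAll (p ∷ q ∷ []) x) → T (accepts (run s x))
    to x = Equivalence.from (accepts⇔ x) ∘ Equivalence.to (T-ascentAvoiding {x} {p} {q})
    from : ∀ x → T (accepts (run s x)) → T (isAscentSeq x ∧ avoidsAll (p ∷ q ∷ []) x)
    from x = Equivalence.from (T-ascentAvoiding {x} {p} {q}) ∘ Equivalence.to (accepts⇔ x)

module Avoiding-0101-0102 where

  Avoider : Seq → Set
  Avoider = AscentAvoiding p0101 p0102

  PeakFree : ℕ → Seq → Set
  PeakFree n x = ∀ {i j} → i < j → j ≤ n → ¬ i ∷ j ∷ i ∷ [] ⊆ x

  peakFree-mono : m ≤ n → PeakFree n x → PeakFree m x
  peakFree-mono m≤n free i<j j≤m = free i<j (≤-trans j≤m m≤n)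

  peakFree-∷ʳ : PeakFree n x → PeakFree n (x ∷ʳ n)
  peakFree-∷ʳ free {i} {j} i<j j≤n σ with ∷ʳ-⊆-∷ʳ⁻ (i ∷ j ∷ []) σ
  ... | inj₁ σ′ = free i<j j≤n σ′
  ... | inj₂ (_ , refl) = <⇒≱ i<j j≤n

  avoidsAtEnd⇔peakFree : (AvoidsAtEnd p0101 x n × AvoidsAtEnd p0102 x n) ⇔ PeakFree n x
  avoidsAtEnd⇔peakFree {x} {n} = mk⇔ to from
    where
    to : AvoidsAtEnd p0101 x n × AvoidsAtEnd p0102 x n → PeakFree n x
    to (av₁ , av₂) i<j j≤n with m≤n⇒m<n∨m≡n j≤n
    ... | inj₁ j<n = Equivalence.to avoidsAtEnd-0102 av₂ i<j j<n
    ... | inj₂ refl = Equivalence.to avoidsAtEnd-0101 av₁ i<j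
    from : PeakFree n x → AvoidsAtEnd p0101 x n × AvoidsAtEnd p0102 x n
    from free = Equivalence.from avoidsAtEnd-0101 (λ i<n → free i<n ≤-refl) ,
                Equivalence.from avoidsAtEnd-0102 (λ i<j j<n → free i<j (<⇒≤ j<n))

  avoider-∷ʳ : ∀ h t →
    Avoider (h ∷ t ∷ʳ n) ⇔ (Avoider (h ∷ t) × n ≤ suc (asc (h ∷ t)) × PeakFree n (h ∷ t))
  avoider-∷ʳ {n} h t = mk⇔ to from
    where
    to : Avoider (h ∷ t ∷ʳ n) → Avoider (h ∷ t) × n ≤ suc (asc (h ∷ t)) × PeakFree n (h ∷ t)
    to ok with Equivalence.to (ascentAvoiding-∷ʳ h t) ok
    ... | ok′ , n≤ , ends = ok′ , n≤ , Equivalence.to avoidsAtEnd⇔peakFree ends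
    from : Avoider (h ∷ t) × n ≤ suc (asc (h ∷ t)) × PeakFree n (h ∷ t) → Avoider (h ∷ t ∷ʳ n)
    from (ok , n≤ , free) =
      Equivalence.from (ascentAvoiding-∷ʳ h t) (ok , n≤ , Equivalence.from avoidsAtEnd⇔peakFree free)

  -- rising k: weakly increasing so far, with maximum k; falling c: past the first descent, last entry c.
  data State : Set where
    start : State
    rising : ℕ → State
    falling : ℕ → State
    dead : State

  step : State → ℕ → State
  step start zero = rising 0
  step start (suc _) = dead
  step (rising k) n with <-cmp n k
  ... | tri< _ _ _ = falling n
  ... | tri≈ _ _ _ = rising k
  ... | tri> _ _ _ with n ≟ suc k
  ...   | yes _ = rising (suc k)
  ...   | no _ = dead
  step (falling c) n with n ≤? c
  ... | yes _ = falling n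
  ... | no _ = dead
  step dead _ = dead

  accepts : State → Bool
  accepts dead = false
  accepts _ = true

  WeaklyIncreasing : Seq → Set
  WeaklyIncreasing x = ∀ {i j} → i ∷ j ∷ [] ⊆ x → i ≤ j

  Stairs : ℕ → Seq → Set
  Stairs k x = ∀ {i} → i < k → i ∷ suc i ∷ [] ⊆ x

  increasing⇒peakFree : WeaklyIncreasing x → PeakFree n x
  increasing⇒peakFree incr i<j _ σ = <⇒≱ i<j (incr (∷ˡ⁻ σ))

  increasing-∷ʳ : WeaklyIncreasing x → All (_≤ n) x → WeaklyIncreasing (x ∷ʳ n)
  increasing-∷ʳ incr bounded {i} σ with ∷ʳ-⊆-∷ʳ⁻ (i ∷ []) σ
  ... | inj₁ σ′ = incr σ′
  ... | inj₂ (i⊆x , refl) = All.head (All-resp-⊆ i⊆x bounded)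

  record Rising (k : ℕ) (x : Seq) : Set where
    field
      asc≡ : asc x ≡ k
      last≡ : last x ≡ just k
      bounded : All (_≤ k) x
      increasing : WeaklyIncreasing x
      stairs : Stairs k x

  record Falling (c : ℕ) (x : Seq) : Set where
    field
      c≤asc : c ≤ asc x
      peakFree : PeakFree c x
      stairs : Stairs (suc c) x
      peak : c ∷ suc c ∷ c ∷ [] ⊆ x

  -- Invariant s t describes 0 ∷ t when s is the state reached from rising 0 by reading t.
  Invariant : State → Seq → Set
  Invariant start t = ⊥
  Invariant (rising k) t = Avoider (0 ∷ t) × Rising k (0 ∷ t)
  Invariant (falling c) t = Avoider (0 ∷ t) × Falling c (0 ∷ t)
  Invariant dead t = ¬ Avoider (0 ∷ t)

  rising-stay : Invariant (rising k) t → Invariant (rising k) (t ∷ʳ k)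
  rising-stay {k} {t} (ok , r) =
    Equivalence.from (avoider-∷ʳ 0 t) (ok , k≤1+asc , increasing⇒peakFree increasing) , record
      { asc≡ = trans (asc-∷ʳ-≤ (0 ∷ t) last≡ ≤-refl) asc≡
      ; last≡ = last-∷ʳ (0 ∷ t)
      ; bounded = All.∷ʳ⁺ bounded ≤-refl
      ; increasing = increasing-∷ʳ increasing bounded
      ; stairs = λ i<k → ⊆-∷ʳ (stairs i<k)
      }
    where
    open Rising r
    k≤1+asc : k ≤ suc (asc (0 ∷ t))
    k≤1+asc = subst (λ z → k ≤ suc z) (sym asc≡) (n≤1+n k)

  rising-climb : Invariant (rising k) t → Invariant (rising (suc k)) (t ∷ʳ suc k)
  rising-climb {k} {t} (ok , r) =
    Equivalence.from (avoider-∷ʳ 0 t) (ok , s≤s (≤-reflexive (sym asc≡)) , increasing⇒peakFree increasing) ,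
    record
      { asc≡ = trans (asc-∷ʳ-< (0 ∷ t) last≡ ≤-refl) (cong suc asc≡)
      ; last≡ = last-∷ʳ (0 ∷ t)
      ; bounded = bounded′
      ; increasing = increasing-∷ʳ increasing (All.∷ʳ⁻ bounded′ .proj₁)
      ; stairs = stairs′
      }
    where
    open Rising r
    bounded′ : All (_≤ suc k) (0 ∷ t ∷ʳ suc k)
    bounded′ = All.∷ʳ⁺ (All.map m≤n⇒m≤1+n bounded) ≤-refl
    stairs′ : Stairs (suc k) (0 ∷ t ∷ʳ suc k)
    stairs′ i<1+k with m≤n⇒m<n∨m≡n (≤-pred i<1+k)
    ... | inj₁ i<k = ⊆-∷ʳ (stairs i<k)
    ... | inj₂ refl = ∷ʳ-⊆-∷ʳ (last-⊆ (0 ∷ t) last≡)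

  rising-fall : n < k → Invariant (rising k) t → Invariant (falling n) (t ∷ʳ n)
  rising-fall {n} {k} {t} n<k (ok , r) =
    Equivalence.from (avoider-∷ʳ 0 t) (ok , n≤1+asc , increasing⇒peakFree increasing) , record
      { c≤asc = ≤-trans (<⇒≤ n<k) (≤-trans (≤-reflexive (sym asc≡)) (asc-∷ʳ-mono (0 ∷ t)))
      ; peakFree = peakFree-∷ʳ (increasing⇒peakFree increasing)
      ; stairs = λ i<1+n → ⊆-∷ʳ (stairs (≤-<-trans (≤-pred i<1+n) n<k))
      ; peak = ∷ʳ-⊆-∷ʳ (stairs n<k)
      }
    where
    open Rising r
    n≤1+asc : n ≤ suc (asc (0 ∷ t))
    n≤1+asc = ≤-trans (<⇒≤ n<k) (subst (λ z → k ≤ suc z) (sym asc≡) (n≤1+n k))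

  rising-jump : suc k < n → Invariant (rising k) t → Invariant dead (t ∷ʳ n)
  rising-jump {k} {n} {t} 1+k<n (_ , r) ok =
    <⇒≱ 1+k<n (subst (λ z → n ≤ suc z) (Rising.asc≡ r) (Equivalence.to (avoider-∷ʳ 0 t) ok .proj₂ .proj₁))

  falling-fall : n ≤ c → Invariant (falling c) t → Invariant (falling n) (t ∷ʳ n)
  falling-fall {n} {c} {t} n≤c (ok , f) =
    Equivalence.from (avoider-∷ʳ 0 t) (ok , ≤-trans n≤c (≤-trans c≤asc (n≤1+n _)) , peakFree-mono n≤c peakFree) ,
    record
      { c≤asc = ≤-trans n≤c (≤-trans c≤asc (asc-∷ʳ-mono (0 ∷ t)))
      ; peakFree = peakFree-∷ʳ (peakFree-mono n≤c peakFree)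
      ; stairs = λ i<1+n → ⊆-∷ʳ (stairs (≤-trans i<1+n (s≤s n≤c)))
      ; peak = ∷ʳ-⊆-∷ʳ (stairs (s≤s n≤c))
      }
    where open Falling f

  falling-rise : c < n → Invariant (falling c) t → Invariant dead (t ∷ʳ n)
  falling-rise {c} {n} {t} c<n (_ , f) ok =
    Equivalence.to (avoider-∷ʳ 0 t) ok .proj₂ .proj₂ (n<1+n c) c<n (Falling.peak f)

  dead-stays : Invariant dead t → Invariant dead (t ∷ʳ n)
  dead-stays {t} ¬ok ok = ¬ok (Equivalence.to (avoider-∷ʳ 0 t) ok .proj₁)

  step-invariant : ∀ {s t} n → Invariant s t → Invariant (step s n) (t ∷ʳ n)
  step-invariant {rising k} n inv with <-cmp n k
  ... | tri< n<k _ _ = rising-fall n<k inv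
  ... | tri≈ _ refl _ = rising-stay inv
  ... | tri> _ _ k<n with n ≟ suc k
  ...   | yes refl = rising-climb inv
  ...   | no n≢1+k = rising-jump (≤∧≢⇒< k<n (n≢1+k ∘ sym)) inv
  step-invariant {falling c} n inv with n ≤? c
  ... | yes n≤c = falling-fall n≤c inv
  ... | no n≰c = falling-rise (≰⇒> n≰c) inv
  step-invariant {dead} n inv = dead-stays inv

  open Automaton step accepts

  invariant-accepts : ∀ {s t} → Invariant s t → T (accepts s) ⇔ Avoider (0 ∷ t)
  invariant-accepts {rising k} (ok , _) = mk⇔ (λ _ → ok) (λ _ → tt)
  invariant-accepts {falling c} (ok , _) = mk⇔ (λ _ → ok) (λ _ → tt)
  invariant-accepts {dead} ¬ok = mk⇔ (λ ()) ¬ok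

  initial : Invariant (rising 0) []
  initial = ascentAvoiding-short tt (s≤s (s≤s z≤n)) (s≤s (s≤s z≤n)) , record
    { asc≡ = refl
    ; last≡ = refl
    ; bounded = z≤n All.∷ All.[]
    ; increasing = λ { (_ ∷ʳ′ ()) ; (refl ∷ ()) }
    ; stairs = λ ()
    }

  accepts⇔avoider : ∀ x → T (accepts (run start x)) ⇔ Avoider x
  accepts⇔avoider [] = mk⇔ (λ _ → ascentAvoiding-short tt (s≤s z≤n) (s≤s z≤n)) (λ _ → tt)
  accepts⇔avoider (zero ∷ t) = invariant-accepts (run-invariant Invariant step-invariant t initial)
  accepts⇔avoider (suc _ ∷ t) =
    mk⇔ (λ acc → ⊥-elim (subst (T ∘ accepts) (run-absorbing (λ _ → refl) t) acc)) (λ { (() , _) })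

  fallCount : ℕ → ℕ → ℕ
  fallCount c zero = 1
  fallCount c (suc j) = ∑< (suc c) (λ i → fallCount i j)

  riseCount : ℕ → ℕ → ℕ
  riseCount k zero = 1
  riseCount k (suc j) = ∑< k (λ i → fallCount i j) + riseCount k j + riseCount (suc k) j

  step-falling-≤ : i ≤ c → step (falling c) i ≡ falling i
  step-falling-≤ {i} {c} i≤c with i ≤? c
  ... | yes _ = refl
  ... | no i≰c = contradiction i≤c i≰c

  step-falling-> : c < i → step (falling c) i ≡ dead
  step-falling-> {c} {i} c<i with i ≤? c
  ... | yes i≤c = contradiction i≤c (<⇒≱ c<i)
  ... | no _ = refl

  step-rising-< : i < k → step (rising k) i ≡ falling i
  step-rising-< {i} {k} i<k with <-cmp i k
  ... | tri< _ _ _ = refl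
  ... | tri≈ ¬i<k _ _ = contradiction i<k ¬i<k
  ... | tri> ¬i<k _ _ = contradiction i<k ¬i<k

  step-rising-≡ : ∀ k → step (rising k) k ≡ rising k
  step-rising-≡ k with <-cmp k k
  ... | tri< k<k _ _ = contradiction k<k (n≮n k)
  ... | tri≈ _ _ _ = refl
  ... | tri> _ _ k<k = contradiction k<k (n≮n k)

  step-rising-suc : ∀ k → step (rising k) (suc k) ≡ rising (suc k)
  step-rising-suc k with <-cmp (suc k) k
  ... | tri< 1+k<k _ _ = contradiction (<-trans (n<1+n k) 1+k<k) (n≮n k)
  ... | tri≈ _ 1+k≡k _ = contradiction 1+k≡k 1+n≢n
  ... | tri> _ _ _ with suc k ≟ suc k
  ...   | yes _ = refl
  ...   | no 1+k≢1+k = contradiction refl 1+k≢1+k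

  step-rising-> : suc k < i → step (rising k) i ≡ dead
  step-rising-> {k} {i} 1+k<i with <-cmp i k
  ... | tri< i<k _ _ = contradiction (<-trans i<k (<-trans (n<1+n k) 1+k<i)) (n≮n i)
  ... | tri≈ _ refl _ = contradiction (<-trans (n<1+n i) 1+k<i) (n≮n i)
  ... | tri> _ _ _ with i ≟ suc k
  ...   | yes refl = contradiction 1+k<i (n≮n i)
  ...   | no _ = refl

  accepted-dead : ∀ m n → accepted m dead n ≡ 0
  accepted-dead = accepted-absorbing (λ _ → refl) (λ ())

  accepted-falling : c < m → ∀ j → accepted m (falling c) j ≡ fallCount c j
  accepted-falling c<m zero = refl
  accepted-falling {c} {m} c<m (suc j) = begin
    accepted m (falling c) (suc j)                         ≡⟨ accepted-suc m (falling c) j ⟩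
    ∑< m (λ i → accepted m (step (falling c) i) j)         ≡⟨ ∑<-vanishing-tail c<m beyond-c ⟩
    ∑< (suc c) (λ i → accepted m (step (falling c) i) j)   ≡⟨ ∑<-cong (suc c) up-to-c ⟩
    fallCount c (suc j)                                    ∎
    where
    open ≡-Reasoning
    beyond-c : ∀ {i} → suc c ≤ i → i < m → accepted m (step (falling c) i) j ≡ 0
    beyond-c c<i _ = trans (cong (λ s → accepted m s j) (step-falling-> c<i)) (accepted-dead m j)
    up-to-c : ∀ {i} → i < suc c → accepted m (step (falling c) i) j ≡ fallCount i j
    up-to-c {i} i<1+c = trans (cong (λ s → accepted m s j) (step-falling-≤ (≤-pred i<1+c)))
                              (accepted-falling (≤-<-trans (≤-pred i<1+c) c<m) j)

  accepted-rising : ∀ k j → k + j < m → accepted m (rising k) j ≡ riseCount k j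
  accepted-rising k zero _ = refl
  accepted-rising {m} k (suc j) k+1+j<m = begin
    accepted m (rising k) (suc j)                                 ≡⟨ accepted-suc m (rising k) j ⟩
    ∑< m g
      ≡⟨ ∑<-vanishing-tail 2+k≤m beyond-1+k ⟩
    ∑< k g + g k + g (suc k)
      ≡⟨ cong₂ _+_ (cong₂ _+_ (∑<-cong k below-k) stay) climb ⟩
    ∑< k (λ i → fallCount i j) + riseCount k j + riseCount (suc k) j
      ∎
    where
    open ≡-Reasoning
    g : ℕ → ℕ
    g i = accepted m (step (rising k) i) j
    1+k+j<m : suc k + j < m
    1+k+j<m = subst (_< m) (+-suc k j) k+1+j<m
    2+k≤m : suc (suc k) ≤ m
    2+k≤m = ≤-trans (s≤s (s≤s (m≤m+n k j))) 1+k+j<m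
    beyond-1+k : ∀ {i} → suc (suc k) ≤ i → i < m → g i ≡ 0
    beyond-1+k 1+k<i _ = trans (cong (λ s → accepted m s j) (step-rising-> 1+k<i)) (accepted-dead m j)
    below-k : ∀ {i} → i < k → g i ≡ fallCount i j
    below-k i<k = trans (cong (λ s → accepted m s j) (step-rising-< i<k))
                        (accepted-falling (<-trans i<k (≤-trans (n≤1+n (suc k)) 2+k≤m)) j)
    stay : g k ≡ riseCount k j
    stay = trans (cong (λ s → accepted m s j) (step-rising-≡ k))
                 (accepted-rising k j (<-trans (n<1+n (k + j)) 1+k+j<m))
    climb : g (suc k) ≡ riseCount (suc k) j
    climb = trans (cong (λ s → accepted m s j) (step-rising-suc k)) (accepted-rising (suc k) j 1+k+j<m)

  accepted-start : ∀ j → accepted (suc j) start (suc j) ≡ accepted (suc j) (rising 0) j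
  accepted-start j = trans (accepted-suc (suc j) start j) (∑<-head j (λ _ → accepted-dead (suc j) j))

  riseCount-shift : ∀ k j → riseCount (suc k) (suc j) ≡ riseCount k (suc j) + riseCount (suc k) j
  riseCount-fall : ∀ k j → riseCount k (suc j) ≡ riseCount (suc (suc k)) j + fallCount k (suc j)

  riseCount-shift k zero = refl
  riseCount-shift k (suc j) = begin
    (E + D) + P + riseCount (suc (suc k)) (suc j)  ≡⟨ cong ((E + D) + P +_) (riseCount-shift (suc k) j) ⟩
    (E + D) + P + (P + Q)                          ≡⟨ rearrange E D P Q ⟩
    E + (Q + D) + P + P                            ≡⟨ cong (λ r → E + r + P + P) (riseCount-fall k j) ⟨
    E + riseCount k (suc j) + P + P                ∎
    where
    open ≡-Reasoning
    E D P Q : ℕ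
    E = ∑< k (λ i → fallCount i (suc j))
    D = fallCount k (suc j)
    P = riseCount (suc k) (suc j)
    Q = riseCount (suc (suc k)) j
    rearrange : ∀ e d p q → e + d + p + (p + q) ≡ e + (q + d) + p + p
    rearrange = solve-∀

  riseCount-fall k zero = +-comm (∑< k (λ _ → 1) + 1) 1
  riseCount-fall k (suc j) = begin
    E + riseCount k (suc j) + P   ≡⟨ cong (λ r → E + r + P) (riseCount-fall k j) ⟩
    E + (Q + D) + P               ≡⟨ rearrange E D P Q ⟩
    (P + Q) + (E + D)             ≡⟨ cong (_+ (E + D)) (riseCount-shift (suc k) j) ⟨
    riseCount (suc (suc k)) (suc j) + (E + D)  ∎
    where
    open ≡-Reasoning
    E D P Q : ℕ
    E = ∑< k (λ i → fallCount i (suc j))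
    D = fallCount k (suc j)
    P = riseCount (suc k) (suc j)
    Q = riseCount (suc (suc k)) j
    rearrange : ∀ e d p q → e + (q + d) + p ≡ (p + q) + (e + d)
    rearrange = solve-∀

  riseCount-fib : ∀ j → riseCount 0 j ≡ F (suc (2 * j)) × riseCount 1 j ≡ F (2 + 2 * j)
  riseCount-fib zero = refl , refl
  riseCount-fib (suc j) with riseCount-fib j
  ... | r₀ , r₁ = r₀′ , r₁′
    where
    open ≡-Reasoning
    r₀′ : riseCount 0 (suc j) ≡ F (suc (2 * suc j))
    r₀′ = begin
      riseCount 0 j + riseCount 1 j        ≡⟨ cong₂ _+_ r₀ r₁ ⟩
      F (suc (2 * j)) + F (2 + 2 * j)      ≡⟨ +-comm (F (suc (2 * j))) _ ⟩
      F (3 + 2 * j)                        ≡⟨ cong (F ∘ suc) (*-suc 2 j) ⟨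
      F (suc (2 * suc j))                  ∎
    r₁′ : riseCount 1 (suc j) ≡ F (2 + 2 * suc j)
    r₁′ = begin
      riseCount 1 (suc j)                  ≡⟨ riseCount-shift 0 j ⟩
      riseCount 0 (suc j) + riseCount 1 j  ≡⟨ cong₂ _+_ r₀′ r₁ ⟩
      F (suc (2 * suc j)) + F (2 + 2 * j)  ≡⟨ cong (λ i → F (suc (2 * suc j)) + F i) (*-suc 2 j) ⟨
      F (2 + 2 * suc j)                    ∎

  a≡F : ∀ j → a (p0101 ∷ p0102 ∷ []) (suc j) ≡ F (suc (2 * j))
  a≡F j = begin
    a (p0101 ∷ p0102 ∷ []) (suc j)  ≡⟨ a≡accepted start accepts⇔avoider (suc j) ⟩
    accepted (suc j) start (suc j)  ≡⟨ accepted-start j ⟩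
    accepted (suc j) (rising 0) j   ≡⟨ accepted-rising 0 j ≤-refl ⟩
    riseCount 0 j                   ≡⟨ proj₁ (riseCount-fib j) ⟩
    F (suc (2 * j))                 ∎
    where open ≡-Reasoning

module Avoiding-0101-0121 where

  Avoider : Seq → Set
  Avoider = AscentAvoiding p0101 p0121

  Blocked : ℕ → Seq → Set
  Blocked n x = (∃[ i ] (i < n × i ∷ n ∷ i ∷ [] ⊆ x)) ⊎
                (∃[ i ] ∃[ k ] (i < n × n < k × i ∷ n ∷ k ∷ [] ⊆ x))

  blocked-∷ʳ : Blocked n x → Blocked n (x ∷ʳ m)
  blocked-∷ʳ (inj₁ (i , i<n , σ)) = inj₁ (i , i<n , ⊆-∷ʳ σ)
  blocked-∷ʳ (inj₂ (i , k , i<n , n<k , σ)) = inj₂ (i , k , i<n , n<k , ⊆-∷ʳ σ)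

  ¬blocked-zero : ¬ Blocked 0 x
  ¬blocked-zero (inj₁ (_ , () , _))
  ¬blocked-zero (inj₂ (_ , _ , () , _))

  ¬blocked-absent : All (_≤ m) x → m < n → ¬ Blocked n x
  ¬blocked-absent bounded m<n (inj₁ (_ , _ , σ)) = <⇒≱ m<n (All.lookup (All-resp-⊆ σ bounded) (there (here refl)))
  ¬blocked-absent bounded m<n (inj₂ (_ , _ , _ , _ , σ)) =
    <⇒≱ m<n (All.lookup (All-resp-⊆ σ bounded) (there (here refl)))

  avoidsAtEnd⇔¬blocked : (AvoidsAtEnd p0101 x n × AvoidsAtEnd p0121 x n) ⇔ (¬ Blocked n x)
  avoidsAtEnd⇔¬blocked {x} {n} = mk⇔ to from
    where
    to : AvoidsAtEnd p0101 x n × AvoidsAtEnd p0121 x n → ¬ Blocked n x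
    to (av₁ , _) (inj₁ (_ , i<n , σ)) = Equivalence.to avoidsAtEnd-0101 av₁ i<n σ
    to (_ , av₂) (inj₂ (_ , _ , i<n , n<k , σ)) = Equivalence.to avoidsAtEnd-0121 av₂ i<n n<k σ
    from : ¬ Blocked n x → AvoidsAtEnd p0101 x n × AvoidsAtEnd p0121 x n
    from free =
      Equivalence.from avoidsAtEnd-0101 (λ {i} i<n σ → free (inj₁ (i , i<n , σ))) ,
      Equivalence.from avoidsAtEnd-0121 (λ {i} {k} i<n n<k σ → free (inj₂ (i , k , i<n , n<k , σ)))

  avoider-∷ʳ : ∀ h t →
    Avoider (h ∷ t ∷ʳ n) ⇔ (Avoider (h ∷ t) × n ≤ suc (asc (h ∷ t)) × ¬ Blocked n (h ∷ t))
  avoider-∷ʳ {n} h t = mk⇔ to from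
    where
    to : Avoider (h ∷ t ∷ʳ n) → Avoider (h ∷ t) × n ≤ suc (asc (h ∷ t)) × ¬ Blocked n (h ∷ t)
    to ok with Equivalence.to (ascentAvoiding-∷ʳ h t) ok
    ... | ok′ , n≤ , ends = ok′ , n≤ , Equivalence.to avoidsAtEnd⇔¬blocked ends
    from : Avoider (h ∷ t) × n ≤ suc (asc (h ∷ t)) × ¬ Blocked n (h ∷ t) → Avoider (h ∷ t ∷ʳ n)
    from (ok , n≤ , free) =
      Equivalence.from (ascentAvoiding-∷ʳ h t) (ok , n≤ , Equivalence.from avoidsAtEnd⇔¬blocked free)

  -- atZero k: last entry 0 and maximum k; atMax k: last entry equal to the maximum, which is suc k.
  data State : Set where
    start : State
    atZero : ℕ → State
    atMax : ℕ → State
    dead : State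

  step : State → ℕ → State
  step start zero = atZero 0
  step start (suc _) = dead
  step (atZero k) zero = atZero k
  step (atZero k) (suc n) with n ≟ k
  ... | yes _ = atMax k
  ... | no _ = dead
  step (atMax k) zero = atZero (suc k)
  step (atMax k) (suc n) with n ≟ k
  ... | yes _ = atMax k
  ... | no _ with n ≟ suc k
  ...   | yes _ = atMax (suc k)
  ...   | no _ = dead
  step dead _ = dead

  accepts : State → Bool
  accepts dead = false
  accepts _ = true

  record AtZero (k : ℕ) (x : Seq) : Set where
    field
      asc≡ : asc x ≡ k
      last≡ : last x ≡ just 0
      bounded : All (_≤ k) x
      blocked : ∀ {n} → n < k → Blocked (suc n) x

  record AtMax (k : ℕ) (x : Seq) : Set where
    field
      asc≡ : asc x ≡ suc k
      last≡ : last x ≡ just (suc k)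
      bounded : All (_≤ suc k) x
      afterMax : ∀ {i} → suc k ∷ i ∷ [] ⊆ x → suc k ≤ i
      zeroMax : 0 ∷ suc k ∷ [] ⊆ x
      blocked : ∀ {n} → n < k → Blocked (suc n) x

  Invariant : State → Seq → Set
  Invariant start t = ⊥
  Invariant (atZero k) t = Avoider (0 ∷ t) × AtZero k (0 ∷ t)
  Invariant (atMax k) t = Avoider (0 ∷ t) × AtMax k (0 ∷ t)
  Invariant dead t = ¬ Avoider (0 ∷ t)

  back-to-zero : Avoider (0 ∷ t) → asc (0 ∷ t) ≡ k → last (0 ∷ t) ≡ just l → All (_≤ k) (0 ∷ t) →
                 (∀ {n} → n < k → Blocked (suc n) (0 ∷ t ∷ʳ 0)) → Invariant (atZero k) (t ∷ʳ 0)
  back-to-zero {t} ok asc≡ last≡ bounded blocked =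
    Equivalence.from (avoider-∷ʳ 0 t) (ok , z≤n , ¬blocked-zero) , record
      { asc≡ = trans (asc-∷ʳ-≤ (0 ∷ t) last≡ z≤n) asc≡
      ; last≡ = last-∷ʳ (0 ∷ t)
      ; bounded = All.∷ʳ⁺ bounded z≤n
      ; blocked = blocked
      }

  new-max : Avoider (0 ∷ t) → asc (0 ∷ t) ≡ k → last (0 ∷ t) ≡ just l → All (_≤ k) (0 ∷ t) →
            (∀ {n} → n < k → Blocked (suc n) (0 ∷ t ∷ʳ suc k)) → Invariant (atMax k) (t ∷ʳ suc k)
  new-max {t} {k} {l} ok asc≡ last≡ bounded blocked =
    Equivalence.from (avoider-∷ʳ 0 t) (ok , s≤s (≤-reflexive (sym asc≡)) , ¬blocked-absent bounded ≤-refl) ,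
    record
      { asc≡ = trans (asc-∷ʳ-< (0 ∷ t) last≡ (s≤s l≤k)) (cong suc asc≡)
      ; last≡ = last-∷ʳ (0 ∷ t)
      ; bounded = All.∷ʳ⁺ (All.map m≤n⇒m≤1+n bounded) ≤-refl
      ; afterMax = afterMax
      ; zeroMax = ∷ʳ-⊆-∷ʳ (refl ∷ []⊆-universal t)
      ; blocked = blocked
      }
    where
    l≤k : l ≤ k
    l≤k = All.head (All-resp-⊆ (last-⊆ (0 ∷ t) last≡) bounded)
    afterMax : ∀ {i} → suc k ∷ i ∷ [] ⊆ 0 ∷ t ∷ʳ suc k → suc k ≤ i
    afterMax σ with ∷ʳ-⊆-∷ʳ⁻ (suc k ∷ []) σ
    ... | inj₁ σ′ = contradiction (All.head (All-resp-⊆ σ′ bounded)) 1+n≰n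
    ... | inj₂ (_ , refl) = ≤-refl

  max-stay : Invariant (atMax k) t → Invariant (atMax k) (t ∷ʳ suc k)
  max-stay {k} {t} (ok , r) =
    Equivalence.from (avoider-∷ʳ 0 t) (ok , subst (λ z → suc k ≤ suc z) (sym asc≡) (n≤1+n (suc k)) , ¬blocked) ,
    record
      { asc≡ = trans (asc-∷ʳ-≤ (0 ∷ t) last≡ ≤-refl) asc≡
      ; last≡ = last-∷ʳ (0 ∷ t)
      ; bounded = All.∷ʳ⁺ bounded ≤-refl
      ; afterMax = afterMax′
      ; zeroMax = ⊆-∷ʳ zeroMax
      ; blocked = λ n<k → blocked-∷ʳ (blocked n<k)
      }
    where
    open AtMax r
    ¬blocked : ¬ Blocked (suc k) (0 ∷ t)
    ¬blocked (inj₁ (_ , i<1+k , σ)) = <⇒≱ i<1+k (afterMax (∷ˡ⁻ σ))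
    ¬blocked (inj₂ (_ , _ , _ , 1+k<j , σ)) = <⇒≱ 1+k<j (All.head (All.tail (All.tail (All-resp-⊆ σ bounded))))
    afterMax′ : ∀ {i} → suc k ∷ i ∷ [] ⊆ 0 ∷ t ∷ʳ suc k → suc k ≤ i
    afterMax′ σ with ∷ʳ-⊆-∷ʳ⁻ (suc k ∷ []) σ
    ... | inj₁ σ′ = afterMax σ′
    ... | inj₂ (_ , refl) = ≤-refl

  blocked-dies : Blocked n (0 ∷ t) → Invariant dead (t ∷ʳ n)
  blocked-dies {t = t} b ok = Equivalence.to (avoider-∷ʳ 0 t) ok .proj₂ .proj₂ b

  jump-dies : asc (0 ∷ t) ≡ k → suc k < n → Invariant dead (t ∷ʳ n)
  jump-dies {t} {k} {n} asc≡ 1+k<n ok =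
    <⇒≱ 1+k<n (subst (λ z → n ≤ suc z) asc≡ (Equivalence.to (avoider-∷ʳ 0 t) ok .proj₂ .proj₁))

  dead-stays : Invariant dead t → Invariant dead (t ∷ʳ n)
  dead-stays {t} ¬ok ok = ¬ok (Equivalence.to (avoider-∷ʳ 0 t) ok .proj₁)

  zero-stay : Invariant (atZero k) t → Invariant (atZero k) (t ∷ʳ 0)
  zero-stay (ok , r) = back-to-zero ok asc≡ last≡ bounded (λ n<k → blocked-∷ʳ (blocked n<k))
    where open AtZero r

  zero-climb : Invariant (atZero k) t → Invariant (atMax k) (t ∷ʳ suc k)
  zero-climb (ok , r) = new-max ok asc≡ last≡ bounded (λ n<k → blocked-∷ʳ (blocked n<k))
    where open AtZero r

  max-drop : Invariant (atMax k) t → Invariant (atZero (suc k)) (t ∷ʳ 0)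
  max-drop {k} {t} (ok , r) = back-to-zero ok asc≡ last≡ bounded blocked′
    where
    open AtMax r
    blocked′ : ∀ {n} → n < suc k → Blocked (suc n) (0 ∷ t ∷ʳ 0)
    blocked′ n<1+k with m≤n⇒m<n∨m≡n (≤-pred n<1+k)
    ... | inj₁ n<k = blocked-∷ʳ (blocked n<k)
    ... | inj₂ refl = inj₁ (0 , z<s , ∷ʳ-⊆-∷ʳ zeroMax)

  max-climb : Invariant (atMax k) t → Invariant (atMax (suc k)) (t ∷ʳ suc (suc k))
  max-climb {k} {t} (ok , r) = new-max ok asc≡ last≡ bounded blocked′
    where
    open AtMax r
    blocked′ : ∀ {n} → n < suc k → Blocked (suc n) (0 ∷ t ∷ʳ suc (suc k))
    blocked′ n<1+k with m≤n⇒m<n∨m≡n (≤-pred n<1+k)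
    ... | inj₁ n<k = blocked-∷ʳ (blocked n<k)
    ... | inj₂ refl = inj₂ (0 , suc (suc k) , z<s , ≤-refl , ∷ʳ-⊆-∷ʳ zeroMax)

  step-invariant : ∀ {s t} n → Invariant s t → Invariant (step s n) (t ∷ʳ n)
  step-invariant {atZero k} zero inv = zero-stay inv
  step-invariant {atZero k} (suc n) inv with n ≟ k
  ... | yes refl = zero-climb inv
  ... | no n≢k with <-cmp n k
  ...   | tri< n<k _ _ = blocked-dies (AtZero.blocked (proj₂ inv) n<k)
  ...   | tri≈ _ n≡k _ = contradiction n≡k n≢k
  ...   | tri> _ _ k<n = jump-dies (AtZero.asc≡ (proj₂ inv)) (s≤s k<n)
  step-invariant {atMax k} zero inv = max-drop inv
  step-invariant {atMax k} (suc n) inv with n ≟ k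
  ... | yes refl = max-stay inv
  ... | no n≢k with n ≟ suc k
  ...   | yes refl = max-climb inv
  ...   | no n≢1+k with <-cmp n k
  ...     | tri< n<k _ _ = blocked-dies (AtMax.blocked (proj₂ inv) n<k)
  ...     | tri≈ _ n≡k _ = contradiction n≡k n≢k
  ...     | tri> _ _ k<n = jump-dies (AtMax.asc≡ (proj₂ inv)) (s≤s (≤∧≢⇒< k<n (n≢1+k ∘ sym)))
  step-invariant {dead} n inv = dead-stays inv

  open Automaton step accepts

  invariant-accepts : ∀ {s t} → Invariant s t → T (accepts s) ⇔ Avoider (0 ∷ t)
  invariant-accepts {atZero k} (ok , _) = mk⇔ (λ _ → ok) (λ _ → tt)
  invariant-accepts {atMax k} (ok , _) = mk⇔ (λ _ → ok) (λ _ → tt)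
  invariant-accepts {dead} ¬ok = mk⇔ (λ ()) ¬ok

  initial : Invariant (atZero 0) []
  initial = ascentAvoiding-short tt (s≤s (s≤s z≤n)) (s≤s (s≤s z≤n)) , record
    { asc≡ = refl
    ; last≡ = refl
    ; bounded = z≤n All.∷ All.[]
    ; blocked = λ ()
    }

  accepts⇔avoider : ∀ x → T (accepts (run start x)) ⇔ Avoider x
  accepts⇔avoider [] = mk⇔ (λ _ → ascentAvoiding-short tt (s≤s z≤n) (s≤s z≤n)) (λ _ → tt)
  accepts⇔avoider (zero ∷ t) = invariant-accepts (run-invariant Invariant step-invariant t initial)
  accepts⇔avoider (suc _ ∷ t) =
    mk⇔ (λ acc → ⊥-elim (subst (T ∘ accepts) (run-absorbing (λ _ → refl) t) acc)) (λ { (() , _) })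

  step-atZero-climb : ∀ k → step (atZero k) (suc k) ≡ atMax k
  step-atZero-climb k with k ≟ k
  ... | yes _ = refl
  ... | no k≢k = contradiction refl k≢k

  step-atZero-other : n ≢ k → step (atZero k) (suc n) ≡ dead
  step-atZero-other {n} {k} n≢k with n ≟ k
  ... | yes n≡k = contradiction n≡k n≢k
  ... | no _ = refl

  step-atMax-stay : ∀ k → step (atMax k) (suc k) ≡ atMax k
  step-atMax-stay k with k ≟ k
  ... | yes _ = refl
  ... | no k≢k = contradiction refl k≢k

  step-atMax-climb : ∀ k → step (atMax k) (suc (suc k)) ≡ atMax (suc k)
  step-atMax-climb k with suc k ≟ k
  ... | yes 1+k≡k = contradiction 1+k≡k 1+n≢n
  ... | no _ with suc k ≟ suc k
  ...   | yes _ = refl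
  ...   | no 1+k≢1+k = contradiction refl 1+k≢1+k

  step-atMax-other : n ≢ k → n ≢ suc k → step (atMax k) (suc n) ≡ dead
  step-atMax-other {n} {k} n≢k n≢1+k with n ≟ k
  ... | yes n≡k = contradiction n≡k n≢k
  ... | no _ with n ≟ suc k
  ...   | yes n≡1+k = contradiction n≡1+k n≢1+k
  ...   | no _ = refl

  accepted-dead : ∀ m n → accepted m dead n ≡ 0
  accepted-dead = accepted-absorbing (λ _ → refl) (λ ())

  accepted-atZero : ∀ k j → k + j < m → accepted m (atZero k) j ≡ F (suc (2 * j))
  accepted-atMax : ∀ k j → suc k + j < m → accepted m (atMax k) j ≡ F (2 + 2 * j)

  accepted-atZero k zero _ = refl
  accepted-atZero {m} k (suc j) k+1+j<m = begin
    accepted m (atZero k) (suc j)    ≡⟨ accepted-suc m (atZero k) j ⟩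
    ∑< m g                           ≡⟨ ∑<-vanishing-tail 2+k≤m beyond-1+k ⟩
    ∑< (suc k) g + g (suc k)         ≡⟨ cong (_+ g (suc k)) (∑<-head k below-k) ⟩
    g 0 + g (suc k)                  ≡⟨ cong₂ _+_ stay climb ⟩
    F (suc (2 * j)) + F (2 + 2 * j)  ≡⟨ +-comm (F (suc (2 * j))) _ ⟩
    F (3 + 2 * j)                    ≡⟨ cong (F ∘ suc) (*-suc 2 j) ⟨
    F (suc (2 * suc j))              ∎
    where
    open ≡-Reasoning
    g : ℕ → ℕ
    g i = accepted m (step (atZero k) i) j
    1+k+j<m : suc k + j < m
    1+k+j<m = subst (_< m) (+-suc k j) k+1+j<m
    2+k≤m : suc (suc k) ≤ m
    2+k≤m = ≤-trans (s≤s (s≤s (m≤m+n k j))) 1+k+j<m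
    below-k : ∀ {i} → i < k → g (suc i) ≡ 0
    below-k i<k = trans (cong (λ s → accepted m s j) (step-atZero-other (<⇒≢ i<k))) (accepted-dead m j)
    beyond-1+k : ∀ {i} → suc (suc k) ≤ i → i < m → g i ≡ 0
    beyond-1+k {suc i} (s≤s k<i) _ =
      trans (cong (λ s → accepted m s j) (step-atZero-other (<⇒≢ k<i ∘ sym))) (accepted-dead m j)
    stay : g 0 ≡ F (suc (2 * j))
    stay = accepted-atZero k j (<-trans (n<1+n (k + j)) 1+k+j<m)
    climb : g (suc k) ≡ F (2 + 2 * j)
    climb = trans (cong (λ s → accepted m s j) (step-atZero-climb k)) (accepted-atMax k j 1+k+j<m)

  accepted-atMax k zero _ = refl
  accepted-atMax {m} k (suc j) 1+k+1+j<m = begin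
    accepted m (atMax k) (suc j)
      ≡⟨ accepted-suc m (atMax k) j ⟩
    ∑< m g
      ≡⟨ ∑<-vanishing-tail 3+k≤m beyond-2+k ⟩
    ∑< (suc k) g + g (suc k) + g (suc (suc k))
      ≡⟨ cong (λ z → z + g (suc k) + g (suc (suc k))) (∑<-head k below-k) ⟩
    g 0 + g (suc k) + g (suc (suc k))
      ≡⟨ cong₂ _+_ (cong₂ _+_ to-zero stay) climb ⟩
    F (suc (2 * j)) + F (2 + 2 * j) + F (2 + 2 * j)
      ≡⟨ cong (_+ F (2 + 2 * j)) (+-comm (F (suc (2 * j))) _) ⟩
    F (4 + 2 * j)
      ≡⟨ cong (F ∘ suc ∘ suc) (*-suc 2 j) ⟨
    F (2 + 2 * suc j)
      ∎
    where
    open ≡-Reasoning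
    g : ℕ → ℕ
    g i = accepted m (step (atMax k) i) j
    2+k+j<m : suc (suc k) + j < m
    2+k+j<m = subst (_< m) (+-suc (suc k) j) 1+k+1+j<m
    1+k+j<m : suc k + j < m
    1+k+j<m = <-trans (n<1+n (suc k + j)) 2+k+j<m
    3+k≤m : 3 + k ≤ m
    3+k≤m = ≤-trans (s≤s (s≤s (s≤s (m≤m+n k j)))) 2+k+j<m
    dies : ∀ {i} → i ≢ k → i ≢ suc k → g (suc i) ≡ 0
    dies i≢k i≢1+k =
      trans (cong (λ s → accepted m s j) (step-atMax-other i≢k i≢1+k)) (accepted-dead m j)
    below-k : ∀ {i} → i < k → g (suc i) ≡ 0
    below-k i<k = dies (<⇒≢ i<k) (<⇒≢ (<-trans i<k (n<1+n _)))
    beyond-2+k : ∀ {i} → 3 + k ≤ i → i < m → g i ≡ 0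
    beyond-2+k {suc i} (s≤s 1+k<i) _ = dies (<⇒≢ (<-trans (n<1+n k) 1+k<i) ∘ sym) (<⇒≢ 1+k<i ∘ sym)
    to-zero : g 0 ≡ F (suc (2 * j))
    to-zero = accepted-atZero (suc k) j 1+k+j<m
    stay : g (suc k) ≡ F (2 + 2 * j)
    stay = trans (cong (λ s → accepted m s j) (step-atMax-stay k)) (accepted-atMax k j 1+k+j<m)
    climb : g (suc (suc k)) ≡ F (2 + 2 * j)
    climb = trans (cong (λ s → accepted m s j) (step-atMax-climb k)) (accepted-atMax (suc k) j 2+k+j<m)

  accepted-start : ∀ j → accepted (suc j) start (suc j) ≡ accepted (suc j) (atZero 0) j
  accepted-start j = trans (accepted-suc (suc j) start j) (∑<-head j (λ _ → accepted-dead (suc j) j))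

  a≡F : ∀ j → a (p0101 ∷ p0121 ∷ []) (suc j) ≡ F (suc (2 * j))
  a≡F j = begin
    a (p0101 ∷ p0121 ∷ []) (suc j)  ≡⟨ a≡accepted start accepts⇔avoider (suc j) ⟩
    accepted (suc j) start (suc j)  ≡⟨ accepted-start j ⟩
    accepted (suc j) (atZero 0) j   ≡⟨ accepted-atZero 0 j ≤-refl ⟩
    F (suc (2 * j))                 ∎
    where open ≡-Reasoning

theorem3p1 : ∀ (n : ℕ) → n ≥ 1 →
    (a ((0 ∷ 1 ∷ 0 ∷ 1 ∷ []) ∷ (0 ∷ 1 ∷ 0 ∷ 2 ∷ []) ∷ []) n ≡ F (2 * n ∸ 1))
    × (a ((0 ∷ 1 ∷ 0 ∷ 1 ∷ []) ∷ (0 ∷ 1 ∷ 2 ∷ 1 ∷ []) ∷ []) n ≡ F (2 * n ∸ 1))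
theorem3p1 (suc j) _ =
  trans (Avoiding-0101-0102.a≡F j) (cong F index) , trans (Avoiding-0101-0121.a≡F j) (cong F index)
  where
  index : suc (2 * j) ≡ 2 * suc j ∸ 1
  index = cong (_∸ 1) (sym (*-suc 2 j))
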